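{- Let $k\leq n$ be positive integers. Then there exists a $k$-uniform hypergraph $\mathcal H$ on $n$ vertices with $\delta_{k-1}(\mathcal H)\geq n/2-k-1$ which does not contain an $r$-factor for any odd integer $r$.
   Context: For a $k$-uniform hypergraph $\mathcal H$, $\delta_{k-1}(\mathcal H)$ is the minimum, over all $(k-1)$-subsets $A\subseteq V(\mathcal H)$, of the number of edges of $\mathcal H$ containing $A$. An $r$-factor of $\mathcal H$ is a spanning sub-hypergraph in which every vertex lies in exactly $r$ edges. -}

module Defs where

open import Data.Nat using (ℕ; suc; _*_; _+_; _∸_; _≤_)
open import Data.Fin using (Fin)
open import Data.Fin.Subset using (Subset; ∣_∣)
open import Data.Fin.Subset.Properties using (_∈?_; _⊆?_)
open import Data.List using (List; length; filter)
open import Data.List.Relation.Unary.All using (All)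
open import Data.List.Relation.Unary.Unique.Propositional using (Unique)
open import Data.List.Relation.Binary.Sublist.Propositional using () renaming (_⊆_ to _⊑_)
open import Data.Product using (Σ; ∃; _×_)
open import Relation.Binary.PropositionalEquality using (_≡_)

record UniformHypergraph (k n : ℕ) : Set where
  field
    edges    : List (Subset n)
    distinct : Unique edges
    uniform  : All (λ e → ∣ e ∣ ≡ k) edges

open UniformHypergraph public

codegree : ∀ {n} → List (Subset n) → Subset n → ℕ
codegree E A = length (filter (λ e → A ⊆? e) E)

degree : ∀ {n} → List (Subset n) → Fin n → ℕ
degree E v = length (filter (λ e → v ∈? e) E)

-- δ_{k-1}(H) ≥ n/2 - k - 1, i.e. every (k-1)-subset A lies in at least
-- n/2 - k - 1 edges; multiplied by 2 to stay within ℕ: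
-- codeg(A) ≥ n/2 - k - 1  ⇔  n ≤ 2·codeg(A) + 2k + 2.
MinCodegreeCondition : ∀ {k n} → UniformHypergraph k n → Set
MinCodegreeCondition {k} {n} H =
  ∀ (A : Subset n) → ∣ A ∣ ≡ k ∸ 1 → n ≤ 2 * codegree (edges H) A + 2 * k + 2

HasFactor : ∀ {k n} → UniformHypergraph k n → ℕ → Set
HasFactor {k} {n} H r = Σ (List (Subset n)) λ F → (F ⊑ edges H) × (∀ (v : Fin n) → degree F v ≡ r)

Odd : ℕ → Set
Odd r = ∃ λ m → r ≡ suc (2 * m)

module Submission where

-- Colour the vertices by χ : Fin n → ℙ (parities) and let the weight of a
-- vertex set be the sum of its colours.  H_k(χ) consists of all k-sets of
-- weight 0ℙ.  A (k−1)-set A lies exactly in the edges A ∪ {v}, v ∉ A, with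
-- χ v = weight(A), so its codegree is at least that colour class minus k − 1.
-- Double counting modulo two gives Σ_v deg_F(v)·χ(v) = Σ_{e ∈ F} weight(e) = 0ℙ
-- for every F ⊆ H_k(χ); for an r-factor the left side is r·Σ_v χ(v), so if χ
-- uses the colour 1ℙ an odd number of times then r is even.  Finally the
-- colouring 1,1,0,0,1,1,0,0,… (with a suitable start) is odd and balanced.

open import Defs
open import Data.Nat using (ℕ; _≤_; zero; suc; _+_; _*_; _<_; z≤n; s≤s; parity)
open import Data.Product using (Σ; _×_; _,_)
open import Relation.Nullary using (¬_; does)
open import Data.Nat.Properties
  using (suc-injective; +-suc; +-comm; +-assoc; +-identityʳ; *-distribˡ-+; <⇒≱; n≤1+n; m≤n+m;
         ≤-refl; ≤-trans; ≤-reflexive; +-monoʳ-≤; +-monoˡ-≤; *-monoʳ-≤; module ≤-Reasoning)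
open import Data.Nat.Solver using (module +-*-Solver)
open import Data.Parity.Base as ℙ using (0ℙ; 1ℙ) renaming (Parity to ℙ)
open import Data.Parity.Properties as ℙₚ using (+-homo-+; *-homo-*)
open import Algebra.Properties.Semiring.Sum ℙₚ.+-*-semiring
  using (sum; sum-cong-≗; ∑-distrib-+; sum-replicate-zero; *-distribˡ-sum)
open import Data.Bool using (Bool; true; false)
open import Data.Vec using ([]; _∷_; lookup; tabulate)
open import Data.Vec.Functional using (Vector; head; tail) renaming ([] to []ᵥ; _∷_ to _∷ᵥ_)
open import Data.Fin using (Fin) renaming (zero to fzero; suc to fsuc)
open import Data.Fin.Subset using (Subset; ∣_∣; inside; outside; ∁; _∩_; _⊆_)
open import Data.Fin.Subset.Properties using (_∈?_; _⊆?_; p⊆q⇒∣p∣≤∣q∣)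
open import Data.List using (List; []; _∷_; _++_; map; length; filter)
open import Data.List.Properties using (filter-++; length-++; filter-none)
open import Data.List.Relation.Unary.All as All using (All; []; _∷_)
open import Data.List.Relation.Unary.All.Properties using () renaming (++⁺ to All-++⁺; map⁺ to All-map⁺)
open import Data.List.Relation.Unary.Unique.Propositional using (Unique; []; _∷_)
open import Data.List.Relation.Unary.Unique.Propositional.Properties using ()
  renaming (++⁺ to Unique-++⁺; map⁺ to Unique-map⁺)
open import Data.List.Membership.Propositional using (_∈_)
open import Data.List.Membership.Propositional.Properties using (∈-map⁻)
open import Data.List.Relation.Binary.Sublist.Propositional.Properties using (All-resp-⊆)
open import Data.Empty using (⊥)
open import Data.Vec.Properties using (∷-injectiveʳ)
open import Relation.Binary.PropositionalEquality
  using (_≡_; _≢_; refl; sym; trans; cong; cong₂; module ≡-Reasoning)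

bit : Bool → ℙ
bit true  = 1ℙ
bit false = 0ℙ

bitℕ : Bool → ℕ
bitℕ true  = 1
bitℕ false = 0

∣∷∣ : ∀ {n} b (S : Subset n) → ∣ b ∷ S ∣ ≡ bitℕ b + ∣ S ∣
∣∷∣ true  S = refl
∣∷∣ false S = refl

parity-suc : ∀ m → parity (suc m) ≡ 1ℙ ℙ.+ parity m
parity-suc m = +-homo-+ 1 m

parity-odd : ∀ m → parity (suc (2 * m)) ≡ 1ℙ
parity-odd m = trans (parity-suc (2 * m)) (cong (1ℙ ℙ.+_) (*-homo-* 2 m))

+-cancel : ∀ c p → c ℙ.+ (p ℙ.+ c) ≡ p
+-cancel 0ℙ p  = ℙₚ.+-identityʳ p
+-cancel 1ℙ 0ℙ = refl
+-cancel 1ℙ 1ℙ = refl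

solve-for : ∀ w p c → does (w ℙₚ.≟ p ℙ.+ c) ≡ does (c ℙₚ.≟ p ℙ.+ w)
solve-for 0ℙ 0ℙ 0ℙ = refl
solve-for 0ℙ 0ℙ 1ℙ = refl
solve-for 0ℙ 1ℙ 0ℙ = refl
solve-for 0ℙ 1ℙ 1ℙ = refl
solve-for 1ℙ 0ℙ 0ℙ = refl
solve-for 1ℙ 0ℙ 1ℙ = refl
solve-for 1ℙ 1ℙ 0ℙ = refl
solve-for 1ℙ 1ℙ 1ℙ = refl

move-left : ∀ w p c → does (w ℙₚ.≟ p ℙ.+ c) ≡ does (c ℙ.+ w ℙₚ.≟ p)
move-left 0ℙ 0ℙ 0ℙ = refl
move-left 0ℙ 0ℙ 1ℙ = refl
move-left 0ℙ 1ℙ 0ℙ = refl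
move-left 0ℙ 1ℙ 1ℙ = refl
move-left 1ℙ 0ℙ 0ℙ = refl
move-left 1ℙ 0ℙ 1ℙ = refl
move-left 1ℙ 1ℙ 0ℙ = refl
move-left 1ℙ 1ℙ 1ℙ = refl

weight : ∀ {n} → Vector ℙ n → Subset n → ℙ
weight χ e = sum (λ v → bit (lookup e v) ℙ.* χ v)

colourClass : ∀ {n} → Vector ℙ n → ℙ → Subset n
colourClass χ q = tabulate (λ v → does (χ v ℙₚ.≟ q))

codegree-++ : ∀ {n} (A : Subset n) L M → codegree (L ++ M) A ≡ codegree L A + codegree M A
codegree-++ A L M = trans (cong length (filter-++ (A ⊆?_) L M)) (length-++ (filter (A ⊆?_) L))

codegree-outside : ∀ {n} b (A : Subset n) L → codegree (map (b ∷_) L) (outside ∷ A) ≡ codegree L A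
codegree-outside b A [] = refl
codegree-outside b A (e ∷ L) with does (A ⊆? e)
... | true  = cong suc (codegree-outside b A L)
... | false = codegree-outside b A L

codegree-inside : ∀ {n} (A : Subset n) L → codegree (map (inside ∷_) L) (inside ∷ A) ≡ codegree L A
codegree-inside A [] = refl
codegree-inside A (e ∷ L) with does (A ⊆? e)
... | true  = cong suc (codegree-inside A L)
... | false = codegree-inside A L

codegree-missing : ∀ {n} (A : Subset n) L → codegree (map (outside ∷_) L) (inside ∷ A) ≡ 0
codegree-missing A [] = refl
codegree-missing A (e ∷ L) = codegree-missing A L

codegree-split-outside : ∀ {n} (A : Subset n) L M →
  codegree (map (outside ∷_) L ++ map (inside ∷_) M) (outside ∷ A) ≡ codegree L A + codegree M A
codegree-split-outside A L M =
  trans (codegree-++ (outside ∷ A) (map (outside ∷_) L) (map (inside ∷_) M))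
        (cong₂ _+_ (codegree-outside outside A L) (codegree-outside inside A M))

codegree-split-inside : ∀ {n} (A : Subset n) L M →
  codegree (map (outside ∷_) L ++ map (inside ∷_) M) (inside ∷ A) ≡ codegree M A
codegree-split-inside A L M =
  trans (codegree-++ (inside ∷ A) (map (outside ∷_) L) (map (inside ∷_) M))
        (cong₂ _+_ (codegree-missing A L) (codegree-inside A M))

codegree-small : ∀ {n} (A : Subset n) {L} → All (λ e → ∣ e ∣ < ∣ A ∣) L → codegree L A ≡ 0
codegree-small A small = cong length (filter-none (A ⊆?_) (All.map too-small small))
  where
  too-small : ∀ {e} → ∣ e ∣ < ∣ A ∣ → ¬ (A ⊆ e)
  too-small ∣e∣<∣A∣ A⊆e = <⇒≱ ∣e∣<∣A∣ (p⊆q⇒∣p∣≤∣q∣ A⊆e)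

-- layer k p χ lists, without repetition, every k-subset of weight p.  A set
-- avoiding vertex 0 has the weight of its tail; a set containing vertex 0
-- has weight p exactly when its tail has weight p + χ 0.
layer : ∀ {n} → ℕ → ℙ → Vector ℙ n → List (Subset n)
layer {zero}  zero    0ℙ χ = [] ∷ []
layer {zero}  zero    1ℙ χ = []
layer {zero}  (suc k) p  χ = []
layer {suc n} zero    p  χ = map (outside ∷_) (layer zero p (tail χ))
layer {suc n} (suc k) p  χ =
  map (outside ∷_) (layer (suc k) p (tail χ)) ++ map (inside ∷_) (layer k (p ℙ.+ head χ) (tail χ))

layer-uniform : ∀ {n} k p (χ : Vector ℙ n) → All (λ e → ∣ e ∣ ≡ k) (layer k p χ)
layer-uniform {zero}  zero    0ℙ χ = refl ∷ []
layer-uniform {zero}  zero    1ℙ χ = []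
layer-uniform {zero}  (suc k) p  χ = []
layer-uniform {suc n} zero    p  χ = All-map⁺ (layer-uniform zero p (tail χ))
layer-uniform {suc n} (suc k) p  χ =
  All-++⁺ (All-map⁺ (layer-uniform (suc k) p (tail χ)))
          (All-map⁺ (All.map (cong suc) (layer-uniform k (p ℙ.+ head χ) (tail χ))))

layer-weight : ∀ {n} k p (χ : Vector ℙ n) → All (λ e → weight χ e ≡ p) (layer k p χ)
layer-weight {zero}  zero    0ℙ χ = refl ∷ []
layer-weight {zero}  zero    1ℙ χ = []
layer-weight {zero}  (suc k) p  χ = []
layer-weight {suc n} zero    p  χ = All-map⁺ (layer-weight zero p (tail χ))
layer-weight {suc n} (suc k) p  χ =
  All-++⁺ (All-map⁺ (layer-weight (suc k) p (tail χ)))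
          (All-map⁺ (All.map (λ w≡ → trans (cong (head χ ℙ.+_) w≡) (+-cancel (head χ) p))
                             (layer-weight k (p ℙ.+ head χ) (tail χ))))

outside≢inside : ∀ {n} (L M : List (Subset n)) {e} → e ∈ map (outside ∷_) L → e ∈ map (inside ∷_) M → ⊥
outside≢inside L M e∈L e∈M with ∈-map⁻ (outside ∷_) e∈L | ∈-map⁻ (inside ∷_) e∈M
... | _ , _ , refl | _ , _ , ()

layer-unique : ∀ {n} k p (χ : Vector ℙ n) → Unique (layer k p χ)
layer-unique {zero}  zero    0ℙ χ = [] ∷ []
layer-unique {zero}  zero    1ℙ χ = []
layer-unique {zero}  (suc k) p  χ = []
layer-unique {suc n} zero    p  χ = Unique-map⁺ ∷-injectiveʳ (layer-unique zero p (tail χ))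
layer-unique {suc n} (suc k) p  χ =
  Unique-++⁺ (Unique-map⁺ ∷-injectiveʳ (layer-unique (suc k) p (tail χ)))
             (Unique-map⁺ ∷-injectiveʳ (layer-unique k (p ℙ.+ head χ) (tail χ)))
             (λ (e∈L , e∈M) → outside≢inside _ _ e∈L e∈M)

codegree-layer-same : ∀ {n} k (A : Subset n) p χ → ∣ A ∣ ≡ k →
  codegree (layer k p χ) A ≡ bitℕ (does (weight χ A ℙₚ.≟ p))
codegree-layer-same {zero}  zero    []            0ℙ χ refl = refl
codegree-layer-same {zero}  zero    []            1ℙ χ refl = refl
codegree-layer-same {suc n} zero    (outside ∷ A) p  χ size =
  trans (codegree-outside outside A (layer zero p (tail χ))) (codegree-layer-same zero A p (tail χ) size)
codegree-layer-same {suc n} (suc j) (outside ∷ A) p  χ size = begin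
    codegree (map (outside ∷_) L ++ map (inside ∷_) M) (outside ∷ A)
      ≡⟨ codegree-split-outside A L M ⟩
    codegree L A + codegree M A
      ≡⟨ cong₂ _+_ (codegree-layer-same (suc j) A p (tail χ) size) (codegree-small A smaller) ⟩
    bitℕ (does (weight (tail χ) A ℙₚ.≟ p)) + 0
      ≡⟨ +-identityʳ _ ⟩
    bitℕ (does (weight (tail χ) A ℙₚ.≟ p)) ∎
  where
  open ≡-Reasoning
  L = layer (suc j) p (tail χ)
  M = layer j (p ℙ.+ head χ) (tail χ)
  smaller : All (λ e → ∣ e ∣ < ∣ A ∣) M
  smaller = All.map (λ ∣e∣≡j → ≤-reflexive (trans (cong suc ∣e∣≡j) (sym size))) (layer-uniform j _ (tail χ))
codegree-layer-same {suc n} (suc j) (inside ∷ A) p χ size = begin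
    codegree (map (outside ∷_) L ++ map (inside ∷_) M) (inside ∷ A)
      ≡⟨ codegree-split-inside A L M ⟩
    codegree M A
      ≡⟨ codegree-layer-same j A (p ℙ.+ head χ) (tail χ) (suc-injective size) ⟩
    bitℕ (does (weight (tail χ) A ℙₚ.≟ p ℙ.+ head χ))
      ≡⟨ cong bitℕ (move-left (weight (tail χ) A) p (head χ)) ⟩
    bitℕ (does (head χ ℙ.+ weight (tail χ) A ℙₚ.≟ p)) ∎
  where
  open ≡-Reasoning
  L = layer (suc j) p (tail χ)
  M = layer j (p ℙ.+ head χ) (tail χ)

-- A (j+1)-set containing a j-set A is A ∪ {v} with v ∉ A, and it has weight p
-- exactly when χ v = p + weight(A).
codegree-layer-next : ∀ {n} (A : Subset n) p χ →
  codegree (layer (suc ∣ A ∣) p χ) A ≡ ∣ ∁ A ∩ colourClass χ (p ℙ.+ weight χ A) ∣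
codegree-layer-next {zero}  []            p χ = refl
codegree-layer-next {suc n} (outside ∷ A) p χ = begin
    codegree (map (outside ∷_) L ++ map (inside ∷_) M) (outside ∷ A)
      ≡⟨ codegree-split-outside A L M ⟩
    codegree L A + codegree M A
      ≡⟨ cong₂ _+_ (codegree-layer-next A p (tail χ)) (codegree-layer-same ∣ A ∣ A (p ℙ.+ head χ) (tail χ) refl) ⟩
    ∣ S ∣ + bitℕ (does (w ℙₚ.≟ p ℙ.+ head χ))
      ≡⟨ +-comm ∣ S ∣ _ ⟩
    bitℕ (does (w ℙₚ.≟ p ℙ.+ head χ)) + ∣ S ∣
      ≡⟨ cong (λ b → bitℕ b + ∣ S ∣) (solve-for w p (head χ)) ⟩
    bitℕ (does (head χ ℙₚ.≟ p ℙ.+ w)) + ∣ S ∣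
      ≡⟨ sym (∣∷∣ (does (head χ ℙₚ.≟ p ℙ.+ w)) S) ⟩
    ∣ does (head χ ℙₚ.≟ p ℙ.+ w) ∷ S ∣ ∎
  where
  open ≡-Reasoning
  w = weight (tail χ) A
  S = ∁ A ∩ colourClass (tail χ) (p ℙ.+ w)
  L = layer (suc ∣ A ∣) p (tail χ)
  M = layer ∣ A ∣ (p ℙ.+ head χ) (tail χ)
codegree-layer-next {suc n} (inside ∷ A) p χ = begin
    codegree (map (outside ∷_) L ++ map (inside ∷_) M) (inside ∷ A)
      ≡⟨ codegree-split-inside A L M ⟩
    codegree M A
      ≡⟨ codegree-layer-next A (p ℙ.+ head χ) (tail χ) ⟩
    ∣ ∁ A ∩ colourClass (tail χ) (p ℙ.+ head χ ℙ.+ weight (tail χ) A) ∣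
      ≡⟨ cong (λ q → ∣ ∁ A ∩ colourClass (tail χ) q ∣) (ℙₚ.+-assoc p (head χ) (weight (tail χ) A)) ⟩
    ∣ ∁ A ∩ colourClass (tail χ) (p ℙ.+ (head χ ℙ.+ weight (tail χ) A)) ∣ ∎
  where
  open ≡-Reasoning
  L = layer (suc (suc ∣ A ∣)) p (tail χ)
  M = layer (suc ∣ A ∣) (p ℙ.+ head χ) (tail χ)

∣∁∩∣-bound : ∀ {n} (A S : Subset n) → ∣ S ∣ ≤ ∣ ∁ A ∩ S ∣ + ∣ A ∣
∣∁∩∣-bound []            []           = z≤n
∣∁∩∣-bound (outside ∷ A) (outside ∷ S) = ∣∁∩∣-bound A S
∣∁∩∣-bound (outside ∷ A) (inside ∷ S)  = s≤s (∣∁∩∣-bound A S)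
∣∁∩∣-bound (inside ∷ A)  (s ∷ S)       = begin
    ∣ s ∷ S ∣                   ≤⟨ ∣∷∣≤ s S ⟩
    suc ∣ S ∣                   ≤⟨ s≤s (∣∁∩∣-bound A S) ⟩
    suc (∣ ∁ A ∩ S ∣ + ∣ A ∣)   ≡⟨ sym (+-suc ∣ ∁ A ∩ S ∣ ∣ A ∣) ⟩
    ∣ ∁ A ∩ S ∣ + suc ∣ A ∣     ∎
  where
  open ≤-Reasoning
  ∣∷∣≤ : ∀ {n} b (S : Subset n) → ∣ b ∷ S ∣ ≤ suc ∣ S ∣
  ∣∷∣≤ outside S = n≤1+n ∣ S ∣
  ∣∷∣≤ inside  S = ≤-refl

totalWeight : ∀ {n} → Vector ℙ n → List (Subset n) → ℙ
totalWeight χ []      = 0ℙ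
totalWeight χ (e ∷ F) = weight χ e ℙ.+ totalWeight χ F

totalWeight-zero : ∀ {n} (χ : Vector ℙ n) {F} → All (λ e → weight χ e ≡ 0ℙ) F → totalWeight χ F ≡ 0ℙ
totalWeight-zero χ []         = refl
totalWeight-zero χ (w≡0 ∷ ws) = cong₂ ℙ._+_ w≡0 (totalWeight-zero χ ws)

does-∈? : ∀ {n} (v : Fin n) (e : Subset n) → does (v ∈? e) ≡ lookup e v
does-∈? fzero    (inside  ∷ e) = refl
does-∈? fzero    (outside ∷ e) = refl
does-∈? (fsuc v) (b ∷ e)       = does-∈? v e

parity-degree-∷ : ∀ {n} (e : Subset n) F v →
  parity (degree (e ∷ F) v) ≡ bit (lookup e v) ℙ.+ parity (degree F v)
parity-degree-∷ e F v rewrite sym (does-∈? v e) with does (v ∈? e)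
... | true  = parity-suc (degree F v)
... | false = refl

handshake : ∀ {n} (χ : Vector ℙ n) F → sum (λ v → parity (degree F v) ℙ.* χ v) ≡ totalWeight χ F
handshake {n} χ [] = sum-replicate-zero n
handshake χ (e ∷ F) = begin
    sum (λ v → parity (degree (e ∷ F) v) ℙ.* χ v)
      ≡⟨ sum-cong-≗ (λ v → trans (cong (ℙ._* χ v) (parity-degree-∷ e F v))
                                 (ℙₚ.*-distribʳ-+ (χ v) (bit (lookup e v)) (parity (degree F v)))) ⟩
    sum (λ v → (bit (lookup e v) ℙ.* χ v) ℙ.+ (parity (degree F v) ℙ.* χ v))
      ≡⟨ ∑-distrib-+ (λ v → bit (lookup e v) ℙ.* χ v) (λ v → parity (degree F v) ℙ.* χ v) ⟩
    weight χ e ℙ.+ sum (λ v → parity (degree F v) ℙ.* χ v)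
      ≡⟨ cong (weight χ e ℙ.+_) (handshake χ F) ⟩
    totalWeight χ (e ∷ F) ∎
  where open ≡-Reasoning

evenHypergraph : ∀ {n} k → Vector ℙ n → UniformHypergraph k n
evenHypergraph k χ = record
  { edges    = layer k 0ℙ χ
  ; distinct = layer-unique k 0ℙ χ
  ; uniform  = layer-uniform k 0ℙ χ
  }

-- Every vertex outside a j-set A of colour weight(A) extends A to an edge,
-- so codeg(A) + j is at least the size of that colour class.
evenHypergraph-codegree : ∀ {n j} (χ : Vector ℙ n) (A : Subset n) → ∣ A ∣ ≡ j →
  ∣ colourClass χ (weight χ A) ∣ ≤ codegree (edges (evenHypergraph (suc j) χ)) A + j
evenHypergraph-codegree χ A refl =
  ≤-trans (∣∁∩∣-bound A (colourClass χ (weight χ A)))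
          (≤-reflexive (cong (_+ ∣ A ∣) (sym (codegree-layer-next A 0ℙ χ))))

-- If the colour 1ℙ is used an odd number of times, an r-factor of H_k(χ)
-- would give 0ℙ = Σ_{e ∈ F} weight(e) = Σ_v r·χ(v) = r·1ℙ, so r is even.
evenHypergraph-noOddFactor : ∀ {n} k (χ : Vector ℙ n) → sum χ ≡ 1ℙ →
  ∀ r → Odd r → ¬ HasFactor (evenHypergraph k χ) r
evenHypergraph-noOddFactor k χ oddTotal r (m , r≡odd) (F , F⊑edges , regular) = 0ℙ≢1ℙ (begin
    0ℙ                                            ≡⟨ sym (totalWeight-zero χ (All-resp-⊆ F⊑edges (layer-weight k 0ℙ χ))) ⟩
    totalWeight χ F                               ≡⟨ sym (handshake χ F) ⟩
    sum (λ v → parity (degree F v) ℙ.* χ v)       ≡⟨ sum-cong-≗ (λ v → cong (λ d → parity d ℙ.* χ v) (regular v)) ⟩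
    sum (λ v → parity r ℙ.* χ v)                  ≡⟨ sym (*-distribˡ-sum (parity r) χ) ⟩
    parity r ℙ.* sum χ                            ≡⟨ cong₂ ℙ._*_ (trans (cong parity r≡odd) (parity-odd m)) oddTotal ⟩
    1ℙ                                            ∎)
  where
  open ≡-Reasoning
  0ℙ≢1ℙ : 0ℙ ≢ 1ℙ
  0ℙ≢1ℙ ()

-- Prepending 1ℙ,1ℙ,0ℙ,0ℙ keeps the parity of the number of 1ℙ's and adds two
-- vertices to each colour class.
extend : ∀ {n} → Vector ℙ n → Vector ℙ (4 + n)
extend χ = 1ℙ ∷ᵥ 1ℙ ∷ᵥ 0ℙ ∷ᵥ 0ℙ ∷ᵥ χ

sum-extend : ∀ {n} (χ : Vector ℙ n) → sum (extend χ) ≡ sum χ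
sum-extend χ = ℙₚ.⁻¹-involutive (sum χ)

∣colourClass-extend∣ : ∀ {n} (χ : Vector ℙ n) q → ∣ colourClass (extend χ) q ∣ ≡ 2 + ∣ colourClass χ q ∣
∣colourClass-extend∣ χ 0ℙ = refl
∣colourClass-extend∣ χ 1ℙ = refl

BalancedOddColouring : ℕ → Set
BalancedOddColouring m =
  Σ (Vector ℙ (suc m)) λ χ → sum χ ≡ 1ℙ × (∀ q → suc m ≤ 2 * ∣ colourClass χ q ∣ + 4)

small-colouring : ∀ {m} (χ : Vector ℙ (suc m)) → sum χ ≡ 1ℙ → suc m ≤ 4 → BalancedOddColouring m
small-colouring χ oddTotal few = χ , oddTotal , λ q → ≤-trans few (m≤n+m 4 (2 * ∣ colourClass χ q ∣))

balancedColouring : ∀ m → BalancedOddColouring m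
balancedColouring 0 = small-colouring (1ℙ ∷ᵥ []ᵥ) refl (s≤s z≤n)
balancedColouring 1 = small-colouring (1ℙ ∷ᵥ 0ℙ ∷ᵥ []ᵥ) refl (s≤s (s≤s z≤n))
balancedColouring 2 = small-colouring (1ℙ ∷ᵥ 0ℙ ∷ᵥ 0ℙ ∷ᵥ []ᵥ) refl (s≤s (s≤s (s≤s z≤n)))
balancedColouring 3 = small-colouring (1ℙ ∷ᵥ 1ℙ ∷ᵥ 1ℙ ∷ᵥ 0ℙ ∷ᵥ []ᵥ) refl ≤-refl
balancedColouring (suc (suc (suc (suc m)))) with balancedColouring m
... | χ , oddTotal , balanced = extend χ , trans (sum-extend χ) oddTotal , extended-bound
  where
  extended-bound : ∀ q → 4 + suc m ≤ 2 * ∣ colourClass (extend χ) q ∣ + 4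
  extended-bound q = begin
    4 + suc m                                   ≤⟨ +-monoʳ-≤ 4 (balanced q) ⟩
    4 + (2 * c + 4)                             ≡⟨ sym (+-assoc 4 (2 * c) 4) ⟩
    2 * 2 + 2 * c + 4                           ≡⟨ cong (_+ 4) (sym (*-distribˡ-+ 2 2 c)) ⟩
    2 * (2 + c) + 4                             ≡⟨ cong (λ s → 2 * s + 4) (sym (∣colourClass-extend∣ χ q)) ⟩
    2 * ∣ colourClass (extend χ) q ∣ + 4        ∎
    where
    open ≤-Reasoning
    c = ∣ colourClass χ q ∣

proposition1p5 : ∀ (k n : ℕ) → 1 ≤ k → k ≤ n →
    Σ (UniformHypergraph k n) λ H →
      MinCodegreeCondition H × (∀ (r : ℕ) → Odd r → ¬ HasFactor H r)
proposition1p5 zero    n       ()  _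
proposition1p5 (suc j) zero    _   ()
proposition1p5 (suc j) (suc m) _   _ with balancedColouring m
... | χ , oddTotal , balanced =
  evenHypergraph (suc j) χ , minCodegree , evenHypergraph-noOddFactor (suc j) χ oddTotal
  where
  minCodegree : MinCodegreeCondition (evenHypergraph (suc j) χ)
  minCodegree A ∣A∣≡j = begin
    suc m                           ≤⟨ balanced (weight χ A) ⟩
    2 * ∣ colourClass χ (weight χ A) ∣ + 4
                                    ≤⟨ +-monoˡ-≤ 4 (*-monoʳ-≤ 2 (evenHypergraph-codegree χ A ∣A∣≡j)) ⟩
    2 * (d + j) + 4                 ≡⟨ rearrange d j ⟩
    2 * d + 2 * suc j + 2           ∎
    where
    open ≤-Reasoning
    d = codegree (edges (evenHypergraph (suc j) χ)) A
    rearrange : ∀ d j → 2 * (d + j) + 4 ≡ 2 * d + 2 * suc j + 2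
    rearrange = solve 2 (λ d j → con 2 :* (d :+ j) :+ con 4 := con 2 :* d :+ con 2 :* (con 1 :+ j) :+ con 2) refl
      where open +-*-Solver
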